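{- Let $\ell\ge 3$ and $m\ge 1$ be integers. Let $G$ be the graph consisting of two vertex-disjoint cycles $C_1=(x_0,\dots,x_{\ell-1})$ and $C_2=(y_0,\dots,y_{\ell-1})$ of length $\ell$ together with $\ell$ paths $P_0,\dots,P_{\ell-1}$, each of length $m$, where $P_i$ joins $x_i$ to $y_i$, and the paths are pairwise vertex-disjoint and meet $C_1\cup C_2$ only in their endpoints. Then $G$ is not a core.
   Context: A graph is a core if every endomorphism (adjacency-preserving self-map of the vertex set) is an automorphism. -}

module Defs where

open import Data.Nat using (ℕ; zero; suc)
open import Data.Fin using (Fin; toℕ)
open import Data.Product using (_×_; _,_)
open import Data.Sum using (_⊎_)
open import Relation.Binary.PropositionalEquality using (_≡_)
open import Function.Definitions using (Bijective)

IsEndomorphism : {V : Set} → (V → V → Set) → (V → V) → Set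
IsEndomorphism {V} Adj f = ∀ {u v : V} → Adj u v → Adj (f u) (f v)

IsAutomorphism : {V : Set} → (V → V → Set) → (V → V) → Set
IsAutomorphism {V} Adj f =
  Bijective _≡_ _≡_ f × IsEndomorphism Adj f × (∀ {u v : V} → Adj (f u) (f v) → Adj u v)

IsCore : {V : Set} → (V → V → Set) → Set
IsCore {V} Adj = (f : V → V) → IsEndomorphism Adj f → IsAutomorphism Adj f

data CycStep (n : ℕ) (a b : Fin n) : Set where
  next : suc (toℕ a) ≡ toℕ b → CycStep n a b
  wrap : suc (toℕ a) ≡ n → toℕ b ≡ 0 → CycStep n a b

-- Vertex (i , j) with i : Fin ℓ, j ∈ {0,…,m} is the j-th
-- vertex of path P_i; (i , 0) = x_i and (i , m) = y_i.
-- Directed edges (adjacency is the symmetric closure, see Adj):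
--   path   : (i , j) – (i , j+1)           (edges of P_i)
--   cycle₁ : (i , 0) – (i+1 mod ℓ , 0)     (edges of C₁ = (x_0,…,x_{ℓ-1}))
--   cycle₂ : (i , m) – (i+1 mod ℓ , m)     (edges of C₂ = (y_0,…,y_{ℓ-1}))
V : ℕ → ℕ → Set
V ℓ m = Fin ℓ × Fin (suc m)

data Edge (ℓ m : ℕ) : V ℓ m → V ℓ m → Set where
  path   : ∀ {i j j'} → suc (toℕ j) ≡ toℕ j' → Edge ℓ m (i , j) (i , j')
  cycle₁ : ∀ {i i' j j'} → CycStep ℓ i i' → toℕ j ≡ 0 → toℕ j' ≡ 0 → Edge ℓ m (i , j) (i' , j')
  cycle₂ : ∀ {i i' j j'} → CycStep ℓ i i' → toℕ j ≡ m → toℕ j' ≡ m → Edge ℓ m (i , j) (i' , j')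

Adj : (ℓ m : ℕ) → V ℓ m → V ℓ m → Set
Adj ℓ m u v = Edge ℓ m u v ⊎ Edge ℓ m v u

{-# OPTIONS --safe #-}

-- The map (i , j) ↦ x_{i+j mod ℓ} is a homomorphism of G onto C₁: an edge of P_i
-- becomes one step along C₁, and a C₂-edge y_i y_{i+1} lands on x_{i+m} x_{i+m+1}.
-- For m ≥ 1 it misses the inner vertices of the paths, so it is not an automorphism.
module Submission where

open import Defs
open import Data.Nat using (ℕ; _≤_; _<_; zero; suc; _<?_)
open import Data.Nat.Properties using (≤-antisym; ≮⇒≥; <-irrefl)
open import Data.Nat.GeneralisedArithmetic using (fold)
open import Data.Fin using (Fin; toℕ; fromℕ<) renaming (zero to fzero; suc to fsuc)
open import Data.Fin.Properties using (toℕ-fromℕ<; toℕ-injective; toℕ<n)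
open import Data.Product using (_,_)
open import Data.Sum using (inj₁; inj₂)
open import Function.Definitions using (Surjective)
open import Relation.Nullary using (¬_; yes; no; contradiction)
open import Relation.Binary.PropositionalEquality

automorphism⇒surjective : ∀ {V : Set} {Adj : V → V → Set} {f : V → V} →
                          IsAutomorphism Adj f → Surjective _≡_ _≡_ f
automorphism⇒surjective ((_ , surjective) , _) = surjective

nonSurjectiveEndomorphism⇒¬IsCore : ∀ {V : Set} {Adj : V → V → Set} (f : V → V) →
                                    IsEndomorphism Adj f →
                                    (y : V) → (∀ x → f x ≢ y) → ¬ IsCore Adj
nonSurjectiveEndomorphism⇒¬IsCore f endo y ∉image core
  with automorphism⇒surjective (core f endo) y
... | x , fx≡y = ∉image x (fx≡y refl)

fold-step-seed : ∀ {A : Set} (s : A → A) (z : A) k → fold (s z) s k ≡ s (fold z s k)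
fold-step-seed s z zero    = refl
fold-step-seed s z (suc k) = cong s (fold-step-seed s z k)

module _ {n : ℕ} where

  suc-mod : Fin (suc n) → Fin (suc n)
  suc-mod a with suc (toℕ a) <? suc n
  ... | yes a+1<n+1 = fromℕ< a+1<n+1
  ... | no  _       = fzero

  cycStep-suc-mod : ∀ a → CycStep (suc n) a (suc-mod a)
  cycStep-suc-mod a with suc (toℕ a) <? suc n
  ... | yes a+1<n+1 = next (sym (toℕ-fromℕ< a+1<n+1))
  ... | no  a+1≮n+1 = wrap (≤-antisym (toℕ<n a) (≮⇒≥ a+1≮n+1)) refl

  cycStep⇒≡suc-mod : ∀ {a b} → CycStep (suc n) a b → b ≡ suc-mod a
  cycStep⇒≡suc-mod {a} {b} step with suc (toℕ a) <? suc n | step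
  ... | yes a+1<n+1 | next a+1≡b = toℕ-injective (trans (sym a+1≡b) (sym (toℕ-fromℕ< a+1<n+1)))
  ... | yes a+1<n+1 | wrap a+1≡n+1 _ = contradiction (subst (_< suc n) a+1≡n+1 a+1<n+1) (<-irrefl refl)
  ... | no  a+1≮n+1 | next a+1≡b = contradiction (subst (_< suc n) (sym a+1≡b) (toℕ<n b)) a+1≮n+1
  ... | no  _       | wrap _ b≡0 = toℕ-injective b≡0

module _ {n m : ℕ} where

  wind : V (suc n) m → V (suc n) m
  wind (i , j) = fold i suc-mod (toℕ j) , fzero

  wind-edge : ∀ {u v} → Edge (suc n) m u v → Edge (suc n) m (wind u) (wind v)
  wind-edge {i , _} (path j+1≡j') rewrite sym j+1≡j' =
    cycle₁ (cycStep-suc-mod _) refl refl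
  wind-edge {i , _} (cycle₁ step j≡0 j'≡0) rewrite j≡0 | j'≡0 | cycStep⇒≡suc-mod step =
    cycle₁ (cycStep-suc-mod i) refl refl
  wind-edge {i , _} (cycle₂ step j≡m j'≡m)
    rewrite j≡m | j'≡m | cycStep⇒≡suc-mod step | fold-step-seed suc-mod i m =
    cycle₁ (cycStep-suc-mod _) refl refl

  wind-isEndomorphism : IsEndomorphism (Adj (suc n) m) wind
  wind-isEndomorphism (inj₁ e) = inj₁ (wind-edge e)
  wind-isEndomorphism (inj₂ e) = inj₂ (wind-edge e)

wind-misses-path : ∀ {n m} (i : Fin (suc n)) (j : Fin (suc m)) v →
                   wind v ≢ (i , fsuc j)
wind-misses-path i j v ()

lemma2p6 : (ℓ m : ℕ) → 3 ≤ ℓ → 1 ≤ m → ¬ IsCore (Adj ℓ m)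
lemma2p6 (suc n) (suc m) _ _ =
  nonSurjectiveEndomorphism⇒¬IsCore wind wind-isEndomorphism
    (fzero , fsuc fzero) (wind-misses-path fzero fzero)
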